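{- Let $\mathcal{S}=\langle\mathcal{L},\vdash\rangle$ be a logic, with $\mathcal{L}$ a formula algebra over a denumerable set of variables $V$, that satisfies monotonicity for trivial sets. If $\mathcal{S}$ is NF-paraconsistent, then its right variable inclusion companion $\mathcal{S}^r$ is also NF-paraconsistent.
   Context: A logic is a pair $\langle\mathcal{L},\vdash\rangle$ with $\vdash\,\subseteq\mathcal{P}(\mathcal{L})\times\mathcal{L}$, and $C_\vdash(\Gamma)=\{\alpha:\Gamma\vdash\alpha\}$. $\mathcal{L}$ is the formula algebra over a denumerable set $V$ of variables in a finite signature; a substitution is an endomorphism $\sigma$ of $\mathcal{L}$. $\mathrm{var}(\alpha)$ is the set of variables in $\alpha$; $\mathrm{var}(\Gamma)=\bigcup_{\alpha\in\Gamma}\mathrm{var}(\alpha)$. A set $\Gamma$ is $\mathcal{S}$-trivial if $C_\vdash(\Gamma)=\mathcal{L}$. $\mathcal{S}$ satisfies monotonicity for trivial sets if every superset of an $\mathcal{S}$-trivial set is $\mathcal{S}$-trivial. An $\mathcal{S}$-antitheorem is a set $\Sigma\subseteq\mathcal{L}$ such that $C_\vdash(\sigma(\Sigma))=\mathcal{L}$ for every substitution $\sigma$. $\mathcal{S}^r=\langle\mathcal{L},\vdash^r\rangle$ where $\Gamma\vdash^r\alpha$ iff either $\Gamma$ contains (as a subset) an $\mathcal{S}$-antitheorem, or $\Gamma\vdash\alpha$ and $\mathrm{var}(\alpha)\subseteq\mathrm{var}(\Gamma)$. A logic is NF-paraconsistent if there exists $\alpha\in\mathcal{L}$ such that $C_\vdash(\{\alpha,\beta\})\neq\mathcal{L}$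 for every $\beta\in\mathcal{L}$. -}

module Defs where

open import Data.Nat using (ℕ)
open import Data.Fin using (Fin)
open import Data.Product using (Σ; ∃; _×_; _,_)
open import Data.Sum using (_⊎_)
open import Relation.Nullary using (¬_)
open import Relation.Binary.PropositionalEquality using (_≡_)

record Signature : Set where
  field
    nOps  : ℕ
    arity : Fin nOps → ℕ
open Signature public

module _ (Sig : Signature) where

  data Formula : Set where
    var : ℕ → Formula
    op  : (i : Fin (nOps Sig)) → (Fin (arity Sig i) → Formula) → Formula

  FSet : Set₁
  FSet = Formula → Set

  _⊆_ : FSet → FSet → Set
  Γ ⊆ Δ = ∀ α → Γ α → Δ α

  pair : Formula → Formula → FSet
  pair α β γ = (γ ≡ α) ⊎ (γ ≡ β)

  Logic : Set₂
  Logic = FSet → Formula → Set₁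

  Trivial : Logic → FSet → Set₁
  Trivial ⊢ Γ = ∀ α → ⊢ Γ α

  MonotoneTrivial : Logic → Set₁
  MonotoneTrivial ⊢ = ∀ Γ Δ → Γ ⊆ Δ → Trivial ⊢ Γ → Trivial ⊢ Δ

  record Substitution : Set where
    field
      fun : Formula → Formula
      hom : ∀ i (f : Fin (arity Sig i) → Formula) →
            fun (op i f) ≡ op i (λ k → fun (f k))
  open Substitution public

  image : Substitution → FSet → FSet
  image σ Σ' β = ∃ λ γ → Σ' γ × fun σ γ ≡ β

  Antitheorem : Logic → FSet → Set₁
  Antitheorem ⊢ Σ' = ∀ (σ : Substitution) → Trivial ⊢ (image σ Σ')

  data _∈var_ (x : ℕ) : Formula → Set where
    here  : x ∈var var x
    there : ∀ {i f} (k : Fin (arity Sig i)) → x ∈var f k → x ∈var op i f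

  _∈varS_ : ℕ → FSet → Set
  x ∈varS Γ = ∃ λ β → Γ β × x ∈var β

  VarIncl : Formula → FSet → Set
  VarIncl α Γ = ∀ x → x ∈var α → x ∈varS Γ

  rvic : Logic → Logic
  rvic ⊢ Γ α = (Σ FSet λ Σ' → Σ' ⊆ Γ × Antitheorem ⊢ Σ') ⊎ (⊢ Γ α × VarIncl α Γ)

  NFParaconsistent : Logic → Set₁
  NFParaconsistent ⊢ = Σ Formula λ α → ∀ β → ¬ Trivial ⊢ (pair α β)

{-# OPTIONS --safe #-}
module Submission where

open import Defs
open import Data.Product using (_,_)
open import Data.Sum using (inj₁; inj₂)
open import Function using (id)
open import Relation.Binary.PropositionalEquality using (refl)

-- Under monotonicity for trivial sets every S^r-consequence is an
-- S-consequence: an antitheorem is S-trivial (take the identity substitution),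
-- hence so is any set containing one. NF-paraconsistency passes to weaker logics.

module _ {Sig : Signature} where

  idSubstitution : Substitution Sig
  idSubstitution = record { fun = id ; hom = λ _ _ → refl }

  image-id-⊆ : ∀ Γ → _⊆_ Sig (image Sig idSubstitution Γ) Γ
  image-id-⊆ Γ β (γ , γ∈Γ , refl) = γ∈Γ

  antitheorem⇒trivial : ∀ {⊢ : Logic Sig} {Σ' : FSet Sig} →
    MonotoneTrivial Sig ⊢ → Antitheorem Sig ⊢ Σ' → Trivial Sig ⊢ Σ'
  antitheorem⇒trivial {Σ' = Σ'} mono anti =
    mono _ Σ' (image-id-⊆ Σ') (anti idSubstitution)

  rvic⇒⊢ : ∀ {⊢ : Logic Sig} → MonotoneTrivial Sig ⊢ →
    ∀ Γ α → rvic Sig ⊢ Γ α → ⊢ Γ α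
  rvic⇒⊢ mono Γ α (inj₁ (Σ' , Σ'⊆Γ , anti)) =
    mono Σ' Γ Σ'⊆Γ (antitheorem⇒trivial mono anti) α
  rvic⇒⊢ mono Γ α (inj₂ (Γ⊢α , _)) = Γ⊢α

  NFParaconsistent-antitone : ∀ {⊢ ⊢′ : Logic Sig} →
    (∀ Γ α → ⊢′ Γ α → ⊢ Γ α) →
    NFParaconsistent Sig ⊢ → NFParaconsistent Sig ⊢′
  NFParaconsistent-antitone ⊢′⇒⊢ (α , nonTrivial) =
    α , λ β trivial′ → nonTrivial β (λ γ → ⊢′⇒⊢ (pair Sig α β) γ (trivial′ γ))

theorem2p27 : (Sig : Signature) (⊢ : Logic Sig) →
    MonotoneTrivial Sig ⊢ →
    NFParaconsistent Sig ⊢ →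
    NFParaconsistent Sig (rvic Sig ⊢)
theorem2p27 Sig ⊢ mono = NFParaconsistent-antitone (rvic⇒⊢ mono)
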